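{- Let $n\ge 2$ and let $\theta$ be a congruence of $\mathbf{L}_n$. The following are equivalent: (1) $\theta$ has exactly one equivalence class; (2) there is $x$ with $x-1\mathrel{\theta}x\mathrel{\theta}x+1$; (3) $0\mathrel{\theta}1$; (4) $n-1\mathrel{\theta}n$.
   Context: For an integer $n\ge 0$, the line $\mathbf{L}_n$ is the frame $\langle\{0,\dots,n\},R\rangle$ where $x\mathrel{R}y$ iff $|x-y|\le 1$. A congruence of $\mathbf{L}_n$ is an equivalence relation $\theta$ on $\{0,\dots,n\}$ such that whenever $x'\mathrel{\theta}x$ and $x\mathrel{R}y$ there is $y'$ with $x'\mathrel{R}y'$ and $y'\mathrel{\theta}y$. -}

module Defs where

open import Level using (Level; suc; _⊔_)
open import Data.Nat using (ℕ; _≤_; _∸_)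
import Data.Nat as ℕ
open import Data.Fin using (Fin; toℕ)
open import Data.Product using (Σ; ∃; _×_)
open import Relation.Binary.Core using (Rel)
open import Relation.Binary.Structures using (IsEquivalence)

Point : ℕ → Set
Point n = Fin (ℕ.suc n)

-- x R y iff |x - y| ≤ 1  (|x-y| = (x ∸ y) + (y ∸ x) on ℕ)
LR : (n : ℕ) → Point n → Point n → Set
LR n x y = (toℕ x ∸ toℕ y) ℕ.+ (toℕ y ∸ toℕ x) ≤ 1

record IsCongruence {ℓ : Level} (n : ℕ) (θ : Rel (Point n) ℓ) : Set ℓ where
  field
    isEquivalence : IsEquivalence θ
    compat : ∀ x x′ y → θ x′ x → LR n x y → Σ (Point n) (λ y′ → LR n x′ y′ × θ y′ y)

module Submission where

-- Everything rests on one observation (`absorb`): if x′ θ x and the whole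
-- neighbourhood of x′ lies in the class of c, then so does every neighbour of
-- x, because the back-and-forth condition sends each step x R y to a step
-- x′ R y′ with y′ θ y.  Three applications of it give the file's lemmas:
--   * at the endpoint 0: if 0 θ 1 then the class of 0 swallows its successor
--     again and again, so θ is total (`everything-in-class-of-zero`);
--   * at the middle of a plateau (x, x+1, x+2): the class absorbs x-1, giving
--     the plateau (x-1, x, x+1); iterating reaches the plateau (0, 1, 2),
--     hence 0 θ 1 (`descend-plateau`);
--   * at the endpoint n: if n-1 θ n then the class absorbs n-2, giving the
--     plateau (n-2, n-1, n) (`top-edge-plateau`).

open import Defs
open import Level using (Level)
open import Data.Nat using (ℕ; _+_; _∸_; _≤_; z≤n; s≤s)
import Data.Nat as ℕ
import Data.Nat.Properties as ℕ
open import Data.Fin using (toℕ; zero; suc; fromℕ; inject₁; fromℕ<)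
open import Data.Fin.Properties using (toℕ-injective; toℕ<n; toℕ≤pred[n]; toℕ-fromℕ<; toℕ-fromℕ; toℕ-inject₁)
open import Data.Product using (Σ; _×_; _,_)
open import Data.Sum using (_⊎_; inj₁; inj₂)
open import Data.Empty using (⊥-elim)
open import Relation.Binary.Core using (Rel)
open import Relation.Binary.Structures using (IsEquivalence)
open import Relation.Binary.PropositionalEquality using (_≡_; refl; sym; trans; cong; subst)
open import Function.Bundles using (_⇔_; mk⇔)

distance≤1 : ∀ a b → (a ∸ b) + (b ∸ a) ≤ 1 → b ≡ a ⊎ b + 1 ≡ a ⊎ a + 1 ≡ b
distance≤1 ℕ.zero ℕ.zero _ = inj₁ refl
distance≤1 ℕ.zero (ℕ.suc ℕ.zero) _ = inj₂ (inj₂ refl)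
distance≤1 ℕ.zero (ℕ.suc (ℕ.suc b)) (s≤s ())
distance≤1 (ℕ.suc ℕ.zero) ℕ.zero _ = inj₂ (inj₁ refl)
distance≤1 (ℕ.suc (ℕ.suc a)) ℕ.zero (s≤s ())
distance≤1 (ℕ.suc a) (ℕ.suc b) d with distance≤1 a b d
... | inj₁ e = inj₁ (cong ℕ.suc e)
... | inj₂ (inj₁ e) = inj₂ (inj₁ (cong ℕ.suc e))
... | inj₂ (inj₂ e) = inj₂ (inj₂ (cong ℕ.suc e))

successor-distance : ∀ a → (a ∸ (a + 1)) + ((a + 1) ∸ a) ≤ 1
successor-distance ℕ.zero = s≤s z≤n
successor-distance (ℕ.suc a) = successor-distance a

module _ {n : ℕ} where

  neighbours : {x w : Point n} → LR n x w → toℕ w ≡ toℕ x ⊎ toℕ w + 1 ≡ toℕ x ⊎ toℕ x + 1 ≡ toℕ w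
  neighbours {x} {w} = distance≤1 (toℕ x) (toℕ w)

  adjacent : {x y : Point n} → toℕ x + 1 ≡ toℕ y → LR n x y
  adjacent {x} e = subst (λ b → (toℕ x ∸ b) + (b ∸ toℕ x) ≤ 1) e (successor-distance (toℕ x))

  LR-sym : {x y : Point n} → LR n x y → LR n y x
  LR-sym {x} {y} = subst (_≤ 1) (ℕ.+-comm (toℕ x ∸ toℕ y) (toℕ y ∸ toℕ x))

  predecessor : (x : Point n) {a : ℕ} → toℕ x ≡ ℕ.suc a → Σ (Point n) (λ w → toℕ w ≡ a)
  predecessor x {a} e = fromℕ< a<1+n , toℕ-fromℕ< a<1+n
    where
    a<1+n : a ℕ.< ℕ.suc n
    a<1+n = ℕ.<⇒≤ (subst (ℕ._< ℕ.suc n) e (toℕ<n x))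

  neighbours-of-zero : {w : Point n} → LR n zero w → toℕ w ≡ 0 ⊎ toℕ w ≡ 1
  neighbours-of-zero lr with neighbours lr
  ... | inj₁ e = inj₁ e
  ... | inj₂ (inj₁ e) = ⊥-elim (ℕ.1+n≢0 (trans (ℕ.+-comm 1 _) e))
  ... | inj₂ (inj₂ e) = inj₂ (sym e)

  neighbours-of-top : {z w : Point n} → toℕ z ≡ n → LR n z w → toℕ w ≡ toℕ z ⊎ toℕ w + 1 ≡ toℕ z
  neighbours-of-top {w = w} ez lr with neighbours lr
  ... | inj₁ e = inj₁ e
  ... | inj₂ (inj₁ e) = inj₂ e
  ... | inj₂ (inj₂ e) = ⊥-elim (ℕ.1+n≰n (subst (_≤ n) n+1≡w (toℕ≤pred[n] w)))
    where
    n+1≡w : toℕ w ≡ ℕ.suc n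
    n+1≡w = trans (sym e) (trans (cong (_+ 1) ez) (ℕ.+-comm n 1))

module Congruence {ℓ : Level} {n : ℕ} {θ : Rel (Point n) ℓ} (C : IsCongruence n θ) where
  open IsCongruence C
  open IsEquivalence isEquivalence renaming (refl to θ-refl; sym to θ-sym; trans to θ-trans)

  θ-≡ : {p q : Point n} → toℕ p ≡ toℕ q → θ p q
  θ-≡ e = subst (θ _) (toℕ-injective e) θ-refl

  Plateau : Point n → Point n → Point n → Set ℓ
  Plateau x y z = toℕ x + 1 ≡ toℕ y × toℕ y + 1 ≡ toℕ z × θ x y × θ y z

  absorb : {x′ x y c : Point n} → θ x′ x → LR n x y → (∀ w → LR n x′ w → θ w c) → θ y c
  absorb {x′} {x} {y} x′θx xRy closed with compat x x′ y x′θx xRy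
  ... | y′ , x′Ry′ , y′θy = θ-trans (θ-sym y′θy) (closed y′ x′Ry′)

  everything-in-class-of-zero : (∀ w → LR n zero w → θ w zero) → ∀ k (p : Point n) → toℕ p ≡ k → θ p zero
  everything-in-class-of-zero closed ℕ.zero p e = θ-≡ e
  everything-in-class-of-zero closed (ℕ.suc k) p e with predecessor p e
  ... | w , ew = absorb (θ-sym (everything-in-class-of-zero closed k w ew)) (adjacent w+1≡p) closed
    where
    w+1≡p : toℕ w + 1 ≡ toℕ p
    w+1≡p = trans (cong (_+ 1) ew) (trans (ℕ.+-comm k 1) (sym e))

  plateau-closed : {x y z : Point n} → Plateau x y z → ∀ w → LR n y w → θ w y
  plateau-closed {x = x} (x+1≡y , y+1≡z , xθy , yθz) w yRw with neighbours yRw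
  ... | inj₁ e = θ-≡ e
  ... | inj₂ (inj₁ e) = θ-trans (θ-≡ (ℕ.+-cancelʳ-≡ 1 (toℕ w) (toℕ x) (trans e (sym x+1≡y)))) xθy
  ... | inj₂ (inj₂ e) = θ-trans (θ-≡ (trans (sym e) y+1≡z)) (θ-sym yθz)

  plateau-step : {x y z : Point n} {a : ℕ} → Plateau x y z → toℕ x ≡ ℕ.suc a
    → Σ (Point n) (λ w → toℕ w ≡ a × Plateau w x y)
  plateau-step {x} {y} {a = a} P@(x+1≡y , _ , xθy , _) ex with predecessor x ex
  ... | w , ew = w , ew , w+1≡x , x+1≡y , θ-trans wθy (θ-sym xθy) , xθy
    where
    w+1≡x : toℕ w + 1 ≡ toℕ x
    w+1≡x = trans (cong (_+ 1) ew) (trans (ℕ.+-comm a 1) (sym ex))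
    wθy : θ w y
    wθy = absorb (θ-sym xθy) (LR-sym {x = w} {y = x} (adjacent w+1≡x)) (plateau-closed P)

  descend-plateau : ∀ a {x y z : Point n} → Plateau x y z → toℕ x ≡ a
    → Σ (Point n) (λ x → Σ (Point n) (λ y → Σ (Point n) (λ z → Plateau x y z × toℕ x ≡ 0)))
  descend-plateau ℕ.zero {x} {y} {z} P ex = x , y , z , P , ex
  descend-plateau (ℕ.suc a) P ex with plateau-step P ex
  ... | w , ew , P′ = descend-plateau a P′ ew

  -- An edge n-1 θ n at the top endpoint, with n ≥ 2, extends to the plateau
  -- (n-2, n-1, n): the class of n contains all neighbours of n, so it absorbs n-2.
  top-edge-plateau : {y z : Point n} {a : ℕ} → toℕ y + 1 ≡ toℕ z → toℕ z ≡ n → toℕ y ≡ ℕ.suc a → θ y z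
    → Σ (Point n) (λ x → Plateau x y z)
  top-edge-plateau {y} {z} {a} y+1≡z ez ey yθz with predecessor y ey
  ... | w , ew = w , w+1≡y , y+1≡z , θ-trans wθz (θ-sym yθz) , yθz
    where
    w+1≡y : toℕ w + 1 ≡ toℕ y
    w+1≡y = trans (cong (_+ 1) ew) (trans (ℕ.+-comm a 1) (sym ey))
    top-closed : ∀ v → LR n z v → θ v z
    top-closed v zRv with neighbours-of-top ez zRv
    ... | inj₁ e = θ-≡ e
    ... | inj₂ e = θ-trans (θ-≡ (ℕ.+-cancelʳ-≡ 1 (toℕ v) (toℕ y) (trans e (sym y+1≡z)))) yθz
    wθz : θ w z
    wθz = absorb (θ-sym yθz) (LR-sym {x = w} {y = y} (adjacent w+1≡y)) top-closed

  bottom-edge-total : {q : Point n} → toℕ q ≡ 1 → θ zero q → ∀ x y → θ x y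
  bottom-edge-total eq zeroθq x y = θ-trans (in-class-of-zero x) (θ-sym (in-class-of-zero y))
    where
    zero-closed : ∀ w → LR n zero w → θ w zero
    zero-closed w zeroRw with neighbours-of-zero zeroRw
    ... | inj₁ e = θ-≡ e
    ... | inj₂ e = θ-trans (θ-≡ (trans e (sym eq))) (θ-sym zeroθq)
    in-class-of-zero : ∀ p → θ p zero
    in-class-of-zero p = everything-in-class-of-zero zero-closed (toℕ p) p refl

  plateau-bottom-edge : {x y z q : Point n} → Plateau x y z → toℕ q ≡ 1 → θ zero q
  plateau-bottom-edge {x} P eq with descend-plateau (toℕ x) P refl
  ... | x₀ , y₀ , _ , (x₀+1≡y₀ , _ , x₀θy₀ , _) , ex₀ =
    θ-trans (θ-≡ (sym ex₀)) (θ-trans x₀θy₀ (θ-≡ (trans (sym x₀+1≡y₀) (trans (cong (_+ 1) ex₀) (sym eq)))))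

lemma2p8 : ∀ {ℓ : Level} (m : ℕ) (θ : Rel (Point (ℕ.suc (ℕ.suc m))) ℓ) → IsCongruence (ℕ.suc (ℕ.suc m)) θ →
    ((∀ x y → θ x y) ⇔ Σ (Point (ℕ.suc (ℕ.suc m))) (λ x → Σ (Point (ℕ.suc (ℕ.suc m))) (λ y → Σ (Point (ℕ.suc (ℕ.suc m))) (λ z → toℕ x + 1 ≡ toℕ y × toℕ y + 1 ≡ toℕ z × θ x y × θ y z))))
    × (Σ (Point (ℕ.suc (ℕ.suc m))) (λ x → Σ (Point (ℕ.suc (ℕ.suc m))) (λ y → Σ (Point (ℕ.suc (ℕ.suc m))) (λ z → toℕ x + 1 ≡ toℕ y × toℕ y + 1 ≡ toℕ z × θ x y × θ y z))) ⇔ θ zero (suc zero))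
    × (θ zero (suc zero) ⇔ θ (inject₁ (fromℕ (ℕ.suc m))) (fromℕ (ℕ.suc (ℕ.suc m))))
lemma2p8 {ℓ} m θ C =
  mk⇔ one-class⇒plateau (λ P → bottom-edge⇒one-class (plateau⇒bottom-edge P)) ,
  mk⇔ plateau⇒bottom-edge (λ h → one-class⇒plateau (bottom-edge⇒one-class h)) ,
  mk⇔ (λ h → bottom-edge⇒one-class h _ _) (λ t → plateau⇒bottom-edge (top-edge⇒plateau t))
  where
  open Congruence C
  L : Set
  L = Point (ℕ.suc (ℕ.suc m))
  HasPlateau : Set ℓ
  HasPlateau = Σ L (λ x → Σ L (λ y → Σ L (λ z → Plateau x y z)))

  one-class⇒plateau : (∀ x y → θ x y) → HasPlateau
  one-class⇒plateau all = zero , suc zero , suc (suc zero) , refl , refl , all _ _ , all _ _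

  plateau⇒bottom-edge : HasPlateau → θ zero (suc zero)
  plateau⇒bottom-edge (_ , _ , _ , P) = plateau-bottom-edge P refl

  bottom-edge⇒one-class : θ zero (suc zero) → ∀ x y → θ x y
  bottom-edge⇒one-class = bottom-edge-total refl

  -- The point n-1 = inject₁ (fromℕ (m+1)) has index m+1 ≥ 1, and n = fromℕ (m+2) follows it.
  index-n-1 : toℕ (inject₁ (fromℕ (ℕ.suc m))) ≡ ℕ.suc m
  index-n-1 = trans (toℕ-inject₁ _) (toℕ-fromℕ _)
  n-1+1≡n : toℕ (inject₁ (fromℕ (ℕ.suc m))) + 1 ≡ toℕ (fromℕ (ℕ.suc (ℕ.suc m)))
  n-1+1≡n = trans (cong (_+ 1) index-n-1) (trans (ℕ.+-comm (ℕ.suc m) 1) (sym (toℕ-fromℕ _)))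

  top-edge⇒plateau : θ (inject₁ (fromℕ (ℕ.suc m))) (fromℕ (ℕ.suc (ℕ.suc m))) → HasPlateau
  top-edge⇒plateau t with top-edge-plateau n-1+1≡n (toℕ-fromℕ _) index-n-1 t
  ... | x , P = x , _ , _ , P
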